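{- Let $\mathcal E$ be an exchangeability system for a noncommutative probability space $(\mathcal A,\phi)$ and let $(X_i)_{i=1}^n$ and $(Y_i)_{i=1}^n$ be families in $\mathcal A$ which are $\mathcal E$-independent. Then $K_n(X_1+Y_1,X_2+Y_2,\dots,X_n+Y_n)=K_n(X_1,\dots,X_n)+K_n(Y_1,\dots,Y_n)$.
   Context: A noncommutative probability space is a pair $(\mathcal A,\phi)$ of a complex unital algebra $\mathcal A$ and a unital linear functional $\phi$. An exchangeability system $\mathcal E$ for $(\mathcal A,\phi)$ consists of a noncommutative probability space $(\mathcal U,\tilde\phi)$ and embeddings (injective unital homomorphisms) $\iota_k:\mathcal A\to\mathcal U$, $k\in\mathbb N$, with $\tilde\phi\circ\iota_k=\phi$; write $X^{(k)}=\iota_k(X)$. It is required that for all $n$, all $X_1,\dots,X_n\in\mathcal A$, all indices $i_1,\dots,i_n\in\mathbb N$ and every permutation $\sigma$ of $\mathbb N$: $\tilde\phi(X_1^{(i_1)}\cdots X_n^{(i_n)})=\tilde\phi(X_1^{(\sigma(i_1))}\cdots X_n^{(\sigma(i_n))})$. Thus this value depends only on the kernel of $j\mapsto i_j$ (the partition of $[n]$ into level sets); for a set partition $\pi$ of $[n]$ denote it $\phi_\pi(X_1,\dots,X_n)$. Two subalgebras $\mathcal B,\mathcal C\subseteq\mathcal A$ are $\mathcal E$-independent if for all $X_1,\dots,X_n\in\mathcal B\cup\mathcal C$ and disjoint $I,J$ with $I\cup J=[n]$, $X_i\in\mathcal B$ ($i\in I$), $X_i\in\mathcal C$ ($i\in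 J$), one has $\phi_\pi(X_1,\dots,X_n)=\phi_{\pi'}(X_1,\dots,X_n)$ whenever $\pi|_I=\pi'|_I$ and $\pi|_J=\pi'|_J$. Two families are $\mathcal E$-independent if the subalgebras they generate are. The $n$-th cumulant is $K_n(X_1,\dots,X_n)=\frac1n\tilde\phi(X_1^\omega\cdots X_n^\omega)$, with $\omega$ a primitive $n$-th root of unity and $X_j^\omega=\sum_{k=1}^n\omega^kX_j^{(k)}$. -}

module Defs where

open import Data.Nat using (ℕ; zero; suc; _<_; _≤_; NonZero)
open import Data.Fin using (Fin; zero; suc)
open import Data.Bool using (Bool; true; false)
open import Data.Product using (_×_)
open import Function.Bundles using (_↔_; Inverse)
open import Relation.Binary.PropositionalEquality using (_≡_; _≢_)
open import Algebra.Core using (Op₁; Op₂)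
open import Algebra.Structures using (IsRing; IsCommutativeRing)

record Field : Set₁ where
  infixl 6 _+_
  infixl 7 _*_
  field
    Carrier : Set
    _+_ _*_ : Op₂ Carrier
    -_      : Op₁ Carrier
    0# 1#   : Carrier
    isCommutativeRing : IsCommutativeRing _≡_ _+_ _*_ -_ 0# 1#
    0≢1     : 0# ≢ 1#
    inv     : (x : Carrier) → x ≢ 0# → Carrier
    inv-r   : ∀ x (p : x ≢ 0#) → x * inv x p ≡ 1#

  fromℕ : ℕ → Carrier
  fromℕ zero    = 0#
  fromℕ (suc n) = 1# + fromℕ n

  _^_ : Carrier → ℕ → Carrier
  x ^ zero  = 1#
  x ^ suc n = x * (x ^ n)

CharZero : Field → Set
CharZero K = ∀ m → Field.fromℕ K (suc m) ≢ Field.0# K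

IsPrimitiveRoot : (K : Field) → ℕ → Field.Carrier K → Set
IsPrimitiveRoot K n ω =
  (ω ^ n ≡ 1#) × (∀ m → 1 ≤ m → m < n → ω ^ m ≢ 1#)
  where open Field K

record Algebra (K : Field) : Set₁ where
  infixl 6 _+_
  infixl 7 _*_
  infixr 7 _·_
  field
    Carrier : Set
    _+_ _*_ : Op₂ Carrier
    -_      : Op₁ Carrier
    0# 1#   : Carrier
    isRing  : IsRing _≡_ _+_ _*_ -_ 0# 1#
    _·_     : Field.Carrier K → Carrier → Carrier
    ·-distribʳ : ∀ a b x → Field._+_ K a b · x ≡ a · x + b · x
    ·-distribˡ : ∀ a x y → a · (x + y) ≡ a · x + a · y
    ·-assoc    : ∀ a b x → Field._*_ K a b · x ≡ a · (b · x)
    ·-identity : ∀ x → Field.1# K · x ≡ x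
    ·-*-assocˡ : ∀ a x y → (a · x) * y ≡ a · (x * y)
    ·-*-assocʳ : ∀ a x y → x * (a · y) ≡ a · (x * y)

  prod : ∀ {n} → (Fin n → Carrier) → Carrier
  prod {zero}  f = 1#
  prod {suc n} f = f zero * prod (λ j → f (suc j))

  -- Σ_{k=1}^{n} f k
  sum1 : ℕ → (ℕ → Carrier) → Carrier
  sum1 zero    f = 0#
  sum1 (suc n) f = sum1 n f + f (suc n)

record Functional {K : Field} (A : Algebra K) : Set where
  field
    fun      : Algebra.Carrier A → Field.Carrier K
    additive : ∀ x y → fun (Algebra._+_ A x y) ≡ Field._+_ K (fun x) (fun y)
    homog    : ∀ a x → fun (Algebra._·_ A a x) ≡ Field._*_ K a (fun x)
    unital   : fun (Algebra.1# A) ≡ Field.1# K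

record Embedding {K : Field} (A B : Algebra K) : Set where
  field
    fun   : Algebra.Carrier A → Algebra.Carrier B
    hom-+ : ∀ x y → fun (Algebra._+_ A x y) ≡ Algebra._+_ B (fun x) (fun y)
    hom-* : ∀ x y → fun (Algebra._*_ A x y) ≡ Algebra._*_ B (fun x) (fun y)
    hom-· : ∀ a x → fun (Algebra._·_ A a x) ≡ Algebra._·_ B a (fun x)
    hom-1 : fun (Algebra.1# A) ≡ Algebra.1# B
    injective : ∀ x y → fun x ≡ fun y → x ≡ y

record ExchangeabilitySystem {K : Field} (A : Algebra K) (φ : Functional A) : Set₁ where
  field
    U  : Algebra K
    φ̃  : Functional U
    ι  : ℕ → Embedding A U
    φ̃∘ι : ∀ k x → Functional.fun φ̃ (Embedding.fun (ι k) x) ≡ Functional.fun φ x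

  _⁽_⁾ : Algebra.Carrier A → ℕ → Algebra.Carrier U
  X ⁽ k ⁾ = Embedding.fun (ι k) X

  mixed : ∀ {n} → (Fin n → Algebra.Carrier A) → (Fin n → ℕ) → Field.Carrier K
  mixed X i = Functional.fun φ̃ (Algebra.prod U (λ j → X j ⁽ i j ⁾))

  field
    exchangeable : ∀ n (X : Fin n → Algebra.Carrier A) (i : Fin n → ℕ) (σ : ℕ ↔ ℕ) →
      mixed X i ≡ mixed X (λ j → Inverse.to σ (i j))

data InSubalg {K : Field} (A : Algebra K) {n : ℕ} (X : Fin n → Algebra.Carrier A)
     : Algebra.Carrier A → Set where
  gen  : ∀ j → InSubalg A X (X j)
  one  : InSubalg A X (Algebra.1# A)
  add  : ∀ {x y} → InSubalg A X x → InSubalg A X y → InSubalg A X (Algebra._+_ A x y)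
  mul  : ∀ {x y} → InSubalg A X x → InSubalg A X y → InSubalg A X (Algebra._*_ A x y)
  smul : ∀ a {x} → InSubalg A X x → InSubalg A X (Algebra._·_ A a x)

-- E-independence.
-- φ_π(X₁,…,X_m) is the common value of mixed X i over index maps i with
-- kernel π; "π|_I = π'|_I" for π = ker i, π' = ker i' means i, i' have the
-- same kernel on I.

SameKernelOn : ∀ {m} → (Fin m → Set) → (Fin m → ℕ) → (Fin m → ℕ) → Set
SameKernelOn P i i' = ∀ j k → P j → P k →
  (i j ≡ i k → i' j ≡ i' k) × (i' j ≡ i' k → i j ≡ i k)

-- Subalgebras given as predicates B, C; the decomposition [m] = I ⊔ J is a
-- colouring c (I = c⁻¹(true), J = c⁻¹(false)).
EIndependent : {K : Field} {A : Algebra K} {φ : Functional A} →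
  ExchangeabilitySystem A φ → (Algebra.Carrier A → Set) → (Algebra.Carrier A → Set) → Set
EIndependent {A = A} E B C =
  ∀ m (Z : Fin m → Algebra.Carrier A) (c : Fin m → Bool) →
  (∀ j → c j ≡ true → B (Z j)) → (∀ j → c j ≡ false → C (Z j)) →
  ∀ (i i' : Fin m → ℕ) →
  SameKernelOn (λ j → c j ≡ true) i i' → SameKernelOn (λ j → c j ≡ false) i i' →
  ExchangeabilitySystem.mixed E Z i ≡ ExchangeabilitySystem.mixed E Z i'

invℕ : (K : Field) → CharZero K → (n : ℕ) → {{NonZero n}} → Field.Carrier K
invℕ K cz (suc m) = Field.inv K (Field.fromℕ K (suc m)) (cz m)

cumulant : {K : Field} (cz : CharZero K) {A : Algebra K} {φ : Functional A} →
  ExchangeabilitySystem A φ → (n : ℕ) → {{NonZero n}} →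
  (ω : Field.Carrier K) → (Fin n → Algebra.Carrier A) → Field.Carrier K
cumulant {K} cz E n ω X =
  Field._*_ K (invℕ K cz n)
    (Functional.fun φ̃ (Algebra.prod U (λ j → Xω (X j))))
  where
  open ExchangeabilitySystem E
  Xω : _ → Algebra.Carrier U
  Xω x = Algebra.sum1 U n (λ k → Algebra._·_ U (Field._^_ K ω k) (x ⁽ k ⁾))

-- Write each X_j^ω + Y_j^ω and multiply out: φ̃(∏ (X_j + Y_j)^ω) is the sum, over colourings
-- c of the positions, of the moments of the mixed products.  Expanding X^ω = Σ_k ω^k X^(k), the
-- moment of a colouring with d ≥ 1 positions coloured false (Y) and at least one coloured true (X) is
-- S = Σ_i ω^(i₁+⋯+iₙ) φ̃(Z₁^(i₁)⋯Zₙ^(iₙ)).  Rotating the indices 1 → 2 → ⋯ → n → 1 at the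
-- Y-positions only is a bijection of the index tuples; it keeps the kernel on each colour class,
-- so by E-independence the mixed moments are unchanged, while the weight gains a factor ω^d.
-- Hence S = ω^d S with ω^d ≠ 1 (as 0 < d < n), so S = 0 and only X and Y themselves survive.
module Submission where

open import Defs
open import Level using (0ℓ)
open import Data.Nat using (ℕ; zero; suc; _≤_; _<_; z≤n; s≤s; NonZero; _≟_)
open import Data.Nat.Properties using (≤-refl; ≤-trans; n≤1+n; m≤n⇒m≤1+n; 1+n≰n; suc-injective)
open import Data.Fin using (Fin; zero; suc)
open import Data.Bool using (Bool; true; false; not; if_then_else_)
import Data.Bool as Bool
open import Data.Bool.Properties using (if-float)
open import Data.Vec using (Vec; []; _∷_; lookup; replicate; zipWith; count)
open import Data.Vec.Properties using (lookup-zipWith; lookup-replicate; count≤n)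
open import Data.Vec.Membership.Propositional using (_∈_)
open import Data.Vec.Relation.Unary.Any using (here; there)
open import Data.Vec.Relation.Unary.All using (All; []; _∷_)
open import Data.Product using (_,_; proj₁; proj₂)
open import Function using (_∘_)
open import Relation.Nullary using (¬_; yes; no; contradiction)
open import Relation.Unary using (Pred; Decidable)
open import Relation.Binary.PropositionalEquality
open import Algebra.Bundles using (Ring; CommutativeRing)
import Algebra.Properties.Ring as RingProperties
import Algebra.Properties.Group as GroupProperties
import Algebra.Properties.CommutativeSemigroup as CommutativeSemigroupProperties

module _ {A : Set} {P : Pred A 0ℓ} (P? : Decidable P) where

  0<count : ∀ {m x} {xs : Vec A m} → P x → x ∈ xs → 0 < count P? xs
  0<count {x = x} px (here refl) with P? x
  ... | yes _  = s≤s z≤n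
  ... | no ¬px = contradiction px ¬px
  0<count px (there {x = y} x∈xs) with P? y
  ... | yes _ = s≤s z≤n
  ... | no _  = 0<count px x∈xs

  count<n : ∀ {m x} {xs : Vec A m} → ¬ P x → x ∈ xs → count P? xs < m
  count<n {x = x} {_ ∷ xs} ¬px (here refl) with P? x
  ... | yes px = contradiction px ¬px
  ... | no _   = s≤s (count≤n P? xs)
  count<n ¬px (there {x = y} x∈xs) with P? y
  ... | yes _ = s≤s (count<n ¬px x∈xs)
  ... | no _  = m≤n⇒m≤1+n (count<n ¬px x∈xs)

choose : ∀ {S : Set} {m} → Vec Bool m → (Fin m → S) → (Fin m → S) → Fin m → S
choose c a b j = if lookup c j then a j else b j

choose-true : ∀ {S : Set} {m} (a b : Fin m → S) j → choose (replicate m true) a b j ≡ a j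
choose-true a b j = cong (λ t → if t then a j else b j) (lookup-replicate j true)

choose-false : ∀ {S : Set} {m} (a b : Fin m → S) j → choose (replicate m false) a b j ≡ b j
choose-false a b j = cong (λ t → if t then a j else b j) (lookup-replicate j false)

cycle : ℕ → ℕ → ℕ
cycle N r with r ≟ N
... | yes _ = 0
... | no _  = suc r

-- rotate N permutes {1,…,N+1} cyclically; it fixes 0 and moves every k > N+1 to k+1.
rotate : ℕ → ℕ → ℕ
rotate N zero    = zero
rotate N (suc r) = suc (cycle N r)

cycle-last : ∀ N → cycle N N ≡ 0
cycle-last N with N ≟ N
... | yes _  = refl
... | no N≢N = contradiction refl N≢N

cycle-≢ : ∀ N {r} → r ≢ N → cycle N r ≡ suc r
cycle-≢ N {r} r≢N with r ≟ N
... | yes r≡N = contradiction r≡N r≢N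
... | no _    = refl

cycle-injective : ∀ N {a b} → cycle N a ≡ cycle N b → a ≡ b
cycle-injective N {a} {b} e with a ≟ N | b ≟ N
... | yes a≡N | yes b≡N = trans a≡N (sym b≡N)
... | yes _   | no _    = contradiction e λ ()
... | no _    | yes _   = contradiction e λ ()
... | no _    | no _    = suc-injective e

rotate-injective : ∀ N {a b} → rotate N a ≡ rotate N b → a ≡ b
rotate-injective N {zero}  {zero}  _ = refl
rotate-injective N {suc a} {suc b} e = cong suc (cycle-injective N (suc-injective e))

sameKernelOn-injective : ∀ {m} {P : Fin m → Set} {i i′ : Fin m → ℕ} (τ : ℕ → ℕ) →
  (∀ {a b} → τ a ≡ τ b → a ≡ b) → (∀ j → P j → i′ j ≡ τ (i j)) → SameKernelOn P i i′
sameKernelOn-injective τ τ-injective i′≡τi j k Pj Pk =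
  (λ e → trans (i′≡τi j Pj) (trans (cong τ e) (sym (i′≡τi k Pk)))) ,
  (λ e → τ-injective (trans (sym (i′≡τi j Pj)) (trans e (i′≡τi k Pk))))

rotateIfFalse : ℕ → Bool → ℕ → ℕ
rotateIfFalse N true  k = k
rotateIfFalse N false k = rotate N k

rotateFalses : ∀ {m} → ℕ → Vec Bool m → Vec ℕ m → Vec ℕ m
rotateFalses N = zipWith (rotateIfFalse N)

module FieldProperties (K : Field) where
  open Field K

  commutativeRing : CommutativeRing 0ℓ 0ℓ
  commutativeRing = record { isCommutativeRing = isCommutativeRing }

  open CommutativeRing commutativeRing public
    using (+-group; *-commutativeSemigroup; isRing;
           -‿inverseʳ; *-comm; *-assoc; *-identityˡ; zeroʳ; distribˡ; distribʳ)
  open RingProperties (CommutativeRing.ring commutativeRing) public using (x+x≈x⇒x≈0; [y-z]x≈yx-zx)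
  open GroupProperties +-group using (x∙y⁻¹≈ε⇒x≈y)
  open CommutativeSemigroupProperties *-commutativeSemigroup public using (interchange; x∙yz≈y∙xz)
  open ≡-Reasoning

  x≡a*x⇒x≡0 : ∀ {a x} → x ≡ a * x → a ≢ 1# → x ≡ 0#
  x≡a*x⇒x≡0 {a} {x} x≡ax a≢1 = begin
    x                        ≡⟨ sym (*-identityˡ x) ⟩
    1# * x                   ≡⟨ cong (_* x) (trans (sym (inv-r d d≢0)) (*-comm d _)) ⟩
    (inv d d≢0 * d) * x      ≡⟨ *-assoc _ d x ⟩
    inv d d≢0 * (d * x)      ≡⟨ cong (inv d d≢0 *_) dx≡0 ⟩
    inv d d≢0 * 0#           ≡⟨ zeroʳ _ ⟩
    0#                       ∎
    where
    d = 1# + - a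
    d≢0 : d ≢ 0#
    d≢0 d≡0 = a≢1 (sym (x∙y⁻¹≈ε⇒x≈y 1# a d≡0))
    dx≡0 : d * x ≡ 0#
    dx≡0 = begin
      (1# + - a) * x       ≡⟨ [y-z]x≈yx-zx x 1# a ⟩
      1# * x + - (a * x)   ≡⟨ cong (λ y → y + - (a * x)) (trans (*-identityˡ x) x≡ax) ⟩
      a * x + - (a * x)    ≡⟨ -‿inverseʳ (a * x) ⟩
      0#                   ∎

scalarAlgebra : (K : Field) → Algebra K
scalarAlgebra K = record
  { Carrier    = Carrier
  ; _+_        = _+_
  ; _*_        = _*_
  ; -_         = -_
  ; 0#         = 0#
  ; 1#         = 1#
  ; isRing     = isRing
  ; _·_        = _*_
  ; ·-distribʳ = λ a b x → distribʳ x a b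
  ; ·-distribˡ = distribˡ
  ; ·-assoc    = *-assoc
  ; ·-identity = *-identityˡ
  ; ·-*-assocˡ = *-assoc
  ; ·-*-assocʳ = λ a x y → x∙yz≈y∙xz x a y
  }
  where open Field K; open FieldProperties K

module Sums {K : Field} (U : Algebra K) where
  open Algebra U hiding (sum1; prod)
  open Algebra U public using (sum1; prod)

  ring : Ring 0ℓ 0ℓ
  ring = record { isRing = isRing }

  open Ring ring using (+-comm; +-assoc; +-identityˡ; +-identityʳ; distribˡ; distribʳ; zeroˡ; zeroʳ)
  open CommutativeSemigroupProperties (Ring.+-commutativeSemigroup ring) using (interchange)
  open ≡-Reasoning

  sum1-cong : ∀ n {f g : ℕ → Carrier} → (∀ k → f (suc k) ≡ g (suc k)) → sum1 n f ≡ sum1 n g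
  sum1-cong zero    eq = refl
  sum1-cong (suc n) eq = cong₂ _+_ (sum1-cong n eq) (eq n)

  sum1-+ : ∀ n (f g : ℕ → Carrier) → sum1 n (λ k → f k + g k) ≡ sum1 n f + sum1 n g
  sum1-+ zero    f g = sym (+-identityʳ 0#)
  sum1-+ (suc n) f g = trans (cong (_+ (f (suc n) + g (suc n))) (sum1-+ n f g)) (interchange _ _ _ _)

  *-distribˡ-sum1 : ∀ n x (f : ℕ → Carrier) → x * sum1 n f ≡ sum1 n (λ k → x * f k)
  *-distribˡ-sum1 zero    x f = zeroʳ x
  *-distribˡ-sum1 (suc n) x f = trans (distribˡ x _ _) (cong (_+ (x * f (suc n))) (*-distribˡ-sum1 n x f))

  *-distribʳ-sum1 : ∀ n (f : ℕ → Carrier) x → sum1 n f * x ≡ sum1 n (λ k → f k * x)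
  *-distribʳ-sum1 zero    f x = zeroˡ x
  *-distribʳ-sum1 (suc n) f x = trans (distribʳ x _ _) (cong (_+ (f (suc n) * x)) (*-distribʳ-sum1 n f x))

  sum1-rotate : ∀ N (g : ℕ → Carrier) → sum1 (suc N) (g ∘ rotate N) ≡ sum1 (suc N) g
  sum1-rotate N g = begin
    sum1 N g′ + g (suc (cycle N N))  ≡⟨ cong (λ r → sum1 N g′ + g (suc r)) (cycle-last N) ⟩
    sum1 N g′ + g 1                  ≡⟨ prefix N ≤-refl ⟩
    sum1 (suc N) g                   ∎
    where
    g′ = g ∘ rotate N
    -- for m ≤ N the first m rotated terms are g 2, …, g (m+1)
    prefix : ∀ m → m ≤ N → sum1 m g′ + g 1 ≡ sum1 (suc m) g
    prefix zero    _   = refl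
    prefix (suc m) m<N = begin
      (sum1 m g′ + g (suc (cycle N m))) + g 1  ≡⟨ cong (λ r → (sum1 m g′ + g (suc r)) + g 1) (cycle-≢ N m≢N) ⟩
      (sum1 m g′ + g (2+m)) + g 1              ≡⟨ +-assoc _ _ _ ⟩
      sum1 m g′ + (g (2+m) + g 1)              ≡⟨ cong (sum1 m g′ +_) (+-comm _ _) ⟩
      sum1 m g′ + (g 1 + g (2+m))              ≡⟨ sym (+-assoc _ _ _) ⟩
      (sum1 m g′ + g 1) + g (2+m)              ≡⟨ cong (_+ g (2+m)) (prefix m (≤-trans (n≤1+n m) m<N)) ⟩
      sum1 (suc m) g + g (2+m)                 ∎
      where
      2+m = suc (suc m)
      m≢N : m ≢ N
      m≢N refl = 1+n≰n m<N

  prod-cong : ∀ {m} {f g : Fin m → Carrier} → (∀ j → f j ≡ g j) → prod f ≡ prod g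
  prod-cong {zero}  eq = refl
  prod-cong {suc m} eq = cong₂ _*_ (eq zero) (prod-cong (λ j → eq (suc j)))

  prod-· : ∀ {m} (a : Fin m → Field.Carrier K) (x : Fin m → Carrier) →
    prod (λ j → a j · x j) ≡ Algebra.prod (scalarAlgebra K) a · prod x
  prod-· {zero}  a x = sym (·-identity 1#)
  prod-· {suc m} a x = begin
    (a zero · x zero) * prod (λ j → a (suc j) · x (suc j))
                                                           ≡⟨ cong ((a zero · x zero) *_) (prod-· (λ j → a (suc j)) (λ j → x (suc j))) ⟩
    (a zero · x zero) * (a′ · x′)                          ≡⟨ ·-*-assocˡ (a zero) (x zero) _ ⟩
    a zero · (x zero * (a′ · x′))                          ≡⟨ cong (a zero ·_) (·-*-assocʳ a′ (x zero) x′) ⟩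
    a zero · (a′ · (x zero * x′))                          ≡⟨ sym (·-assoc (a zero) a′ _) ⟩
    Field._*_ K (a zero) a′ · (x zero * x′)                ∎
    where
    a′ = Algebra.prod (scalarAlgebra K) (λ j → a (suc j))
    x′ = prod (λ j → x (suc j))

  sumTuples : ℕ → ∀ m → (Vec ℕ m → Carrier) → Carrier
  sumTuples n zero    f = f []
  sumTuples n (suc m) f = sum1 n (λ k → sumTuples n m (λ v → f (k ∷ v)))

  sumTuples-cong : ∀ n m {f g : Vec ℕ m → Carrier} →
    (∀ v → All (0 <_) v → f v ≡ g v) → sumTuples n m f ≡ sumTuples n m g
  sumTuples-cong n zero    eq = eq [] []
  sumTuples-cong n (suc m) eq = sum1-cong n λ k → sumTuples-cong n m λ v pos → eq (suc k ∷ v) (s≤s z≤n ∷ pos)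

  *-distribˡ-sumTuples : ∀ n m x (f : Vec ℕ m → Carrier) →
    x * sumTuples n m f ≡ sumTuples n m (λ v → x * f v)
  *-distribˡ-sumTuples n zero    x f = refl
  *-distribˡ-sumTuples n (suc m) x f =
    trans (*-distribˡ-sum1 n x _) (sum1-cong n λ k → *-distribˡ-sumTuples n m x _)

  sumTuples-rotateFalses : ∀ N {m} (c : Vec Bool m) (f : Vec ℕ m → Carrier) →
    sumTuples (suc N) m (λ v → f (rotateFalses N c v)) ≡ sumTuples (suc N) m f
  sumTuples-rotateFalses N []      f = refl
  sumTuples-rotateFalses N (b ∷ c) f = begin
    sum1 (suc N) (λ k → sumTuples (suc N) _ (λ v → f (rotateIfFalse N b k ∷ rotateFalses N c v)))
      ≡⟨ sum1-cong (suc N) (λ k → sumTuples-rotateFalses N c _) ⟩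
    sum1 (suc N) (λ k → g (rotateIfFalse N b k))
      ≡⟨ rotated b ⟩
    sum1 (suc N) g ∎
    where
    g : ℕ → Carrier
    g k = sumTuples (suc N) _ (λ v → f (k ∷ v))
    rotated : ∀ b → sum1 (suc N) (λ k → g (rotateIfFalse N b k)) ≡ sum1 (suc N) g
    rotated true  = refl
    rotated false = sum1-rotate N g

  prod-sum1 : ∀ n m (g : Fin m → ℕ → Carrier) →
    prod (λ j → sum1 n (g j)) ≡ sumTuples n m (λ v → prod (λ j → g j (lookup v j)))
  prod-sum1 n zero    g = refl
  prod-sum1 n (suc m) g = begin
    sum1 n (g zero) * prod (λ j → sum1 n (g (suc j)))
      ≡⟨ cong (sum1 n (g zero) *_) (prod-sum1 n m (λ j → g (suc j))) ⟩
    sum1 n (g zero) * sumTuples n m (λ v → prod (λ j → g (suc j) (lookup v j)))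
      ≡⟨ *-distribʳ-sum1 n (g zero) _ ⟩
    sum1 n (λ k → g zero k * sumTuples n m (λ v → prod (λ j → g (suc j) (lookup v j))))
      ≡⟨ sum1-cong n (λ k → *-distribˡ-sumTuples n m (g zero (suc k)) _) ⟩
    sumTuples n (suc m) (λ v → prod (λ j → g j (lookup v j))) ∎

  sumColourings : ∀ m → (Vec Bool m → Carrier) → Carrier
  sumColourings zero    f = f []
  sumColourings (suc m) f = sumColourings m (λ c → f (true ∷ c)) + sumColourings m (λ c → f (false ∷ c))

  *-distribˡ-sumColourings : ∀ m x (f : Vec Bool m → Carrier) →
    x * sumColourings m f ≡ sumColourings m (λ c → x * f c)
  *-distribˡ-sumColourings zero    x f = refl
  *-distribˡ-sumColourings (suc m) x f =
    trans (distribˡ x _ _) (cong₂ _+_ (*-distribˡ-sumColourings m x _) (*-distribˡ-sumColourings m x _))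

  prod-+ : ∀ m (a b : Fin m → Carrier) →
    prod (λ j → a j + b j) ≡ sumColourings m (λ c → prod (choose c a b))
  prod-+ zero    a b = refl
  prod-+ (suc m) a b = begin
    (a zero + b zero) * P          ≡⟨ distribʳ P (a zero) (b zero) ⟩
    a zero * P + b zero * P        ≡⟨ cong (λ Q → a zero * Q + b zero * Q) (prod-+ m a′ b′) ⟩
    a zero * Q + b zero * Q        ≡⟨ cong₂ _+_ (*-distribˡ-sumColourings m (a zero) _)
                                                (*-distribˡ-sumColourings m (b zero) _) ⟩
    sumColourings (suc m) (λ c → prod (choose c a b)) ∎
    where
    a′ b′ : Fin m → Carrier
    a′ j = a (suc j)
    b′ j = b (suc j)
    P = prod (λ j → a′ j + b′ j)
    Q = sumColourings m (λ c → prod (choose c a′ b′))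

  sumColourings-zero : ∀ m {f : Vec Bool m → Carrier} → (∀ c → f c ≡ 0#) → sumColourings m f ≡ 0#
  sumColourings-zero zero    f≡0 = f≡0 []
  sumColourings-zero (suc m) f≡0 =
    trans (cong₂ _+_ (sumColourings-zero m λ c → f≡0 _) (sumColourings-zero m λ c → f≡0 _)) (+-identityʳ 0#)

  sumColourings-constant : ∀ m b {f : Vec Bool m → Carrier} →
    (∀ c → not b ∈ c → f c ≡ 0#) → sumColourings m f ≡ f (replicate m b)
  sumColourings-constant zero    b     vanish = refl
  sumColourings-constant (suc m) true  vanish = trans
    (cong₂ _+_ (sumColourings-constant m true λ c f∈c → vanish _ (there f∈c))
               (sumColourings-zero m λ c → vanish _ (here refl)))
    (+-identityʳ _)
  sumColourings-constant (suc m) false vanish = trans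
    (cong₂ _+_ (sumColourings-zero m λ c → vanish _ (here refl))
               (sumColourings-constant m false λ c t∈c → vanish _ (there t∈c)))
    (+-identityˡ _)

  sumColourings-unmixed : ∀ m {f : Vec Bool (suc m) → Carrier} →
    (∀ c → true ∈ c → false ∈ c → f c ≡ 0#) →
    sumColourings (suc m) f ≡ f (replicate (suc m) true) + f (replicate (suc m) false)
  sumColourings-unmixed m vanish = cong₂ _+_
    (sumColourings-constant m true  λ c f∈c → vanish _ (here refl) (there f∈c))
    (sumColourings-constant m false λ c t∈c → vanish _ (there t∈c) (here refl))

module LinearFunctional {K : Field} {U : Algebra K} (ψ : Functional U) where
  open Functional ψ
  open Algebra U using (sum1; 0#)
  open Sums U using (sumTuples; sumColourings; ring)
  module Scalar = Sums (scalarAlgebra K)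

  fun-0# : fun 0# ≡ Field.0# K
  fun-0# = FieldProperties.x+x≈x⇒x≈0 K (fun 0#)
    (trans (sym (additive 0# 0#)) (cong fun (Ring.+-identityʳ ring 0#)))

  fun-sum1 : ∀ n (f : ℕ → Algebra.Carrier U) → fun (sum1 n f) ≡ Scalar.sum1 n (λ k → fun (f k))
  fun-sum1 zero    f = fun-0#
  fun-sum1 (suc n) f = trans (additive _ _) (cong (λ s → Field._+_ K s (fun (f (suc n)))) (fun-sum1 n f))

  fun-sumTuples : ∀ n m (f : Vec ℕ m → Algebra.Carrier U) →
    fun (sumTuples n m f) ≡ Scalar.sumTuples n m (λ v → fun (f v))
  fun-sumTuples n zero    f = refl
  fun-sumTuples n (suc m) f = trans (fun-sum1 n _) (Scalar.sum1-cong n λ k → fun-sumTuples n m _)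

  fun-sumColourings : ∀ m (f : Vec Bool m → Algebra.Carrier U) →
    fun (sumColourings m f) ≡ Scalar.sumColourings m (λ c → fun (f c))
  fun-sumColourings zero    f = refl
  fun-sumColourings (suc m) f = trans (additive _ _) (cong₂ (Field._+_ K) (fun-sumColourings m _) (fun-sumColourings m _))

module Moments {K : Field} {A : Algebra K} {φ : Functional A} (E : ExchangeabilitySystem A φ)
    (N : ℕ) (ω : Field.Carrier K) (prim : IsPrimitiveRoot K (suc N) ω) where

  open Field K
  open FieldProperties K using (*-assoc; *-identityˡ; interchange; x∙yz≈y∙xz; x≡a*x⇒x≡0)
  open ExchangeabilitySystem E
  module U = Algebra U
  module Uᵀ = Sums U
  module Kᵀ = Sums (scalarAlgebra K)
  open LinearFunctional φ̃ using (fun-sumTuples; fun-sumColourings)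
  open Functional φ̃ using (fun; homog)
  open ≡-Reasoning

  n : ℕ
  n = suc N

  scaledCopy : Algebra.Carrier A → ℕ → U.Carrier
  scaledCopy x k = (ω ^ k) U.· (x ⁽ k ⁾)

  _^ω : Algebra.Carrier A → U.Carrier
  x ^ω = U.sum1 n (scaledCopy x)

  moment : (Fin n → Algebra.Carrier A) → Carrier
  moment Z = fun (U.prod (λ j → Z j ^ω))

  weight : ∀ {m} → Vec ℕ m → Carrier
  weight v = Kᵀ.prod (λ j → ω ^ lookup v j)

  #false : ∀ {m} → Vec Bool m → ℕ
  #false = count (Bool._≟ false)

  ω^rotate : ∀ k → ω ^ rotate N (suc k) ≡ ω * ω ^ suc k
  ω^rotate k with k ≟ N
  ... | yes refl = cong (ω *_) (sym (proj₁ prim))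
  ... | no _     = refl

  weight-rotateFalses : ∀ {m} (c : Vec Bool m) {v : Vec ℕ m} → All (0 <_) v →
    weight (rotateFalses N c v) ≡ ω ^ #false c * weight v
  weight-rotateFalses []          []        = sym (*-identityˡ 1#)
  weight-rotateFalses (true ∷ c)  {k ∷ v} (_ ∷ pos) = begin
    ω ^ k * weight (rotateFalses N c v)  ≡⟨ cong (ω ^ k *_) (weight-rotateFalses c pos) ⟩
    ω ^ k * (ω ^ #false c * weight v)    ≡⟨ x∙yz≈y∙xz _ _ _ ⟩
    ω ^ #false c * (ω ^ k * weight v)    ∎
  weight-rotateFalses (false ∷ c) {suc k ∷ v} (_ ∷ pos) = begin
    ω ^ rotate N (suc k) * weight (rotateFalses N c v)  ≡⟨ cong₂ _*_ (ω^rotate k) (weight-rotateFalses c pos) ⟩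
    (ω * ω ^ suc k) * (ω ^ #false c * weight v)         ≡⟨ interchange _ _ _ _ ⟩
    (ω * ω ^ #false c) * (ω ^ suc k * weight v)         ∎

  mixed-rotateFalses : ∀ {B C} → EIndependent E B C →
    ∀ {m} (Z : Fin m → Algebra.Carrier A) (c : Vec Bool m) →
    (∀ j → lookup c j ≡ true → B (Z j)) → (∀ j → lookup c j ≡ false → C (Z j)) →
    ∀ v → mixed Z (lookup (rotateFalses N c v)) ≡ mixed Z (lookup v)
  mixed-rotateFalses indep Z c inB inC v = sym
    (indep _ Z (lookup c) inB inC (lookup v) (lookup (rotateFalses N c v))
      (sameKernelOn-injective (λ k → k) (λ e → e) (lookup-rotateFalses true))
      (sameKernelOn-injective (rotate N) (rotate-injective N) (lookup-rotateFalses false)))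
    where
    lookup-rotateFalses : ∀ b j → lookup c j ≡ b →
      lookup (rotateFalses N c v) j ≡ rotateIfFalse N b (lookup v j)
    lookup-rotateFalses b j refl = lookup-zipWith (rotateIfFalse N) j c v

  moment-expansion : ∀ Z → moment Z ≡ Kᵀ.sumTuples n n (λ v → weight v * mixed Z (lookup v))
  moment-expansion Z = begin
    fun (U.prod (λ j → Z j ^ω))
      ≡⟨ cong fun (Uᵀ.prod-sum1 n n (scaledCopy ∘ Z)) ⟩
    fun (Uᵀ.sumTuples n n term)
      ≡⟨ fun-sumTuples n n term ⟩
    Kᵀ.sumTuples n n (λ v → fun (term v))
      ≡⟨ Kᵀ.sumTuples-cong n n {f = λ v → fun (term v)} (λ v _ → term-moment v) ⟩
    Kᵀ.sumTuples n n (λ v → weight v * mixed Z (lookup v)) ∎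
    where
    term : Vec ℕ n → U.Carrier
    term v = U.prod (λ j → scaledCopy (Z j) (lookup v j))
    term-moment : ∀ v → fun (term v) ≡ weight v * mixed Z (lookup v)
    term-moment v = trans (cong fun (Uᵀ.prod-· (λ j → ω ^ lookup v j) (λ j → Z j ⁽ lookup v j ⁾))) (homog _ _)

  moment-vanishes : ∀ {B C} → EIndependent E B C →
    (Z : Fin n → Algebra.Carrier A) (c : Vec Bool n) → true ∈ c → false ∈ c →
    (∀ j → lookup c j ≡ true → B (Z j)) → (∀ j → lookup c j ≡ false → C (Z j)) →
    moment Z ≡ 0#
  moment-vanishes {B} {C} indep Z c t∈c f∈c inB inC =
    trans (moment-expansion Z) (x≡a*x⇒x≡0 S≡aS a≢1)
    where
    a = ω ^ #false c
    a≢1 : a ≢ 1#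
    a≢1 = proj₂ prim (#false c) (0<count _ refl f∈c) (count<n _ (λ ()) t∈c)
    term : Vec ℕ n → Carrier
    term v = weight v * mixed Z (lookup v)
    term-rotated : ∀ v → All (0 <_) v → term (rotateFalses N c v) ≡ a * term v
    term-rotated v pos = trans
      (cong₂ _*_ (weight-rotateFalses c pos) (mixed-rotateFalses {B} {C} indep Z c inB inC v))
      (*-assoc _ _ _)
    S = Kᵀ.sumTuples n n term
    S≡aS : S ≡ a * S
    S≡aS = begin
      S                                                   ≡⟨ sym (Kᵀ.sumTuples-rotateFalses N c term) ⟩
      Kᵀ.sumTuples n n (λ v → term (rotateFalses N c v))
                                                          ≡⟨ Kᵀ.sumTuples-cong n n {g = λ v → a * term v} term-rotated ⟩
      Kᵀ.sumTuples n n (λ v → a * term v)                 ≡⟨ sym (Kᵀ.*-distribˡ-sumTuples n n a term) ⟩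
      a * S                                               ∎

  ^ω-+ : ∀ x y → (Algebra._+_ A x y) ^ω ≡ x ^ω U.+ y ^ω
  ^ω-+ x y = trans (Uᵀ.sum1-cong n {g = λ k → scaledCopy x k U.+ scaledCopy y k} distrib) (Uᵀ.sum1-+ n _ _)
    where
    distrib : ∀ k → scaledCopy (Algebra._+_ A x y) (suc k) ≡ scaledCopy x (suc k) U.+ scaledCopy y (suc k)
    distrib k = trans (cong ((ω ^ suc k) U.·_) (Embedding.hom-+ (ι (suc k)) x y)) (U.·-distribˡ _ _ _)

  moment-+ : (X Y : Fin n → Algebra.Carrier A) → EIndependent E (InSubalg A X) (InSubalg A Y) →
    moment (λ j → Algebra._+_ A (X j) (Y j)) ≡ moment X + moment Y
  moment-+ X Y indep = begin
    fun (U.prod (λ j → (Algebra._+_ A (X j) (Y j)) ^ω))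
      ≡⟨ cong fun (Uᵀ.prod-cong λ j → ^ω-+ (X j) (Y j)) ⟩
    fun (U.prod (λ j → Xω j U.+ Yω j))
      ≡⟨ cong fun (Uᵀ.prod-+ n Xω Yω) ⟩
    fun (Uᵀ.sumColourings n (λ c → U.prod (choose c Xω Yω)))
      ≡⟨ fun-sumColourings n (λ c → U.prod (choose c Xω Yω)) ⟩
    Kᵀ.sumColourings n (λ c → fun (U.prod (choose c Xω Yω)))
      ≡⟨ Kᵀ.sumColourings-unmixed N mixed-vanishes ⟩
    fun (U.prod (choose (replicate n true) Xω Yω)) + fun (U.prod (choose (replicate n false) Xω Yω))
      ≡⟨ cong₂ _+_ (cong fun (Uᵀ.prod-cong (choose-true Xω Yω))) (cong fun (Uᵀ.prod-cong (choose-false Xω Yω))) ⟩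
    moment X + moment Y ∎
    where
    Xω Yω : Fin n → U.Carrier
    Xω j = X j ^ω
    Yω j = Y j ^ω
    mixed-vanishes : ∀ c → true ∈ c → false ∈ c → fun (U.prod (choose c Xω Yω)) ≡ 0#
    mixed-vanishes c t∈c f∈c = trans
      (cong fun (Uᵀ.prod-cong λ j → sym (if-float _^ω (lookup c j) {X j} {Y j})))
      (moment-vanishes {InSubalg A X} {InSubalg A Y} indep (choose c X Y) c t∈c f∈c
        (λ j e → subst (λ t → InSubalg A X (if t then X j else Y j)) (sym e) (InSubalg.gen j))
        (λ j e → subst (λ t → InSubalg A Y (if t then X j else Y j)) (sym e) (InSubalg.gen j)))

corollary2p3 : (K : Field) (cz : CharZero K) (A : Algebra K) (φ : Functional A)
    (E : ExchangeabilitySystem A φ) (n : ℕ) {{_ : NonZero n}}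
    (ω : Field.Carrier K) → IsPrimitiveRoot K n ω →
    (X Y : Fin n → Algebra.Carrier A) →
    EIndependent E (InSubalg A X) (InSubalg A Y) →
    cumulant cz E n ω (λ j → Algebra._+_ A (X j) (Y j))
    ≡ Field._+_ K (cumulant cz E n ω X) (cumulant cz E n ω Y)
corollary2p3 K cz A φ E (suc N) ω prim X Y indep =
  trans (cong (invℕ K cz (suc N) *_) (moment-+ X Y indep)) (distribˡ _ _ _)
  where
  open Field K using (_*_)
  open FieldProperties K using (distribˡ)
  open Moments E N ω prim using (moment-+)
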